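{- Let $p\in\mathcal P$. There is a unique set $p$-DF of formal terms in the operations $\cdot$ and $\circ$ over the alphabet $\{q\in\mathcal P: q\le_L p\}$, and a linear ordering $<_{\mathrm{Lex}}$ of $p$-DF, such that: (i) for each $q\le_L p$, the length-one term $q$ is in $p$-DF, and for $q,r\le_L p$, $q<_{\mathrm{Lex}} r$ if and only if $q<_L r$; (ii) a term $w$ is in $p$-DF if and only if either $w$ is a length-one term $q$ with $q\le_L p$, or $w$ is the left-associated term $pa_0a_1\cdots a_{n-1}\ast a_n$ (for some $n\ge 0$), where each $a_i\in p$-DF and this term is prenormal with respect to $<_{\mathrm{Lex}}$; (iii) defining the associated sequence of $w\in p$-DF to be $\langle w\rangle$ if $w$ is a length-one term $\le_L p$, to be $\langle p,a_0,a_1,\dots,a_n\rangle$ if $w=pa_0a_1\cdots a_n$, and, if $w=pa_0a_1\cdots a_{n-1}\circ a_n$ with $u=pa_0\cdots a_{n-1}$, to be the infinite sequence $\langle p,a_0,\dots,a_{n-1},a_n,I_1(u,a_n),I_2(u,a_n),I_3(u,a_n),\dots\rangle$, we have for $w,v\in p$-DF with associated sequences $\langle w_i:i<\alpha\rangle$, $\langle v_i:i<\beta\rangle$ ($\alpha,\beta\le\omega$): $w<_{\mathrm{Lex}} v$ if and only if either $\langle w_i:i<\alpha\rangle$ is a proper initial segment of $\langle v_i:i<\beta\rangle$, or there is a least $i$ with $w_i\ne v_i$ and for it $w_i<_{\mathrm{Lex}} v_i$.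
   Context: $\mathcal P$ is the free algebra on one generator $x$ with two binary operations $\cdot$ (written as juxtaposition) and $\circ$, satisfying the laws $a\circ(b\circ c)=(a\circ b)\circ c$, $(a\circ b)c=a(bc)$, $a(b\circ c)=ab\circ ac$, $a\circ b=ab\circ a$. Products are left-associated: $p_0p_1\cdots p_n$ denotes $(\cdots((p_0p_1)p_2)\cdots)p_n$, and $p_0p_1\cdots p_{n-1}\circ p_n$ denotes $((\cdots(p_0p_1)\cdots)p_{n-1})\circ p_n$; $p_0p_1\cdots p_{n-1}\ast p_n$ denotes either one of these (the same convention applies to formal terms). For $p,q\in\mathcal P$, $p<_L q$ means $q=pa_0a_1\cdots a_{n-1}\ast a_n$ for some $n\ge0$ and $a_0,\dots,a_n\in\mathcal P$; $<_L$ is known to be a linear order of $\mathcal P$ and to coincide with the relation "$q$ can be written as a term of length $>1$ in $\cdot,\circ$ involving $p$"; $\le_L$ means $<_L$ or $=$. Iterates: $I_1(a,b)=a$, $I_2(a,b)=ab$, $I_{n+2}(a,b)=I_{n+1}(a,b)I_n(a,b)$. A term $b_0b_1\cdots b_{n-1}\ast b_n$ is prenormal with respect to a linear order $\prec$ (with $\preceq$ meaning $\prec$ or $=$) if $b_{k+2}\preceq b_0b_1\cdots b_k$ for all $0\le k\le n-2$, and, in case $\ast=\circ$ and $n\ge2$, moreover $b_n\prec b_0b_1\cdots b_{n-2}$. -}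

module Defs where

open import Data.Nat using (ℕ; zero; suc; _<_)
open import Data.List using (List; []; _∷_; _++_; foldl)
open import Data.List.Relation.Unary.All using (All)
open import Data.Maybe using (Maybe; just; nothing)
open import Data.Product using (Σ; ∃; _×_; _,_)
open import Data.Sum using (_⊎_)
open import Relation.Binary.PropositionalEquality using (_≡_; _≢_)
open import Relation.Nullary using (¬_)
open import Function.Bundles using (_⇔_)

record LDAlg : Set₁ where
  infixl 7 _·_
  infixl 6 _∘_
  field
    Carrier : Set
    _·_ : Carrier → Carrier → Carrier
    _∘_ : Carrier → Carrier → Carrier
    ∘-assoc   : ∀ a b c → a ∘ (b ∘ c) ≡ (a ∘ b) ∘ c
    ∘·-assoc  : ∀ a b c → (a ∘ b) · c ≡ a · (b · c)
    ·-distrib : ∀ a b c → a · (b ∘ c) ≡ (a · b) ∘ (a · c)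
    ∘-law     : ∀ a b → a ∘ b ≡ (a · b) ∘ a

open LDAlg public using (Carrier)

record Hom (A B : LDAlg) : Set where
  private
    module A = LDAlg A
    module B = LDAlg B
  field
    fun    : A.Carrier → B.Carrier
    pres-· : ∀ a b → fun (a A.· b) ≡ fun a B.· fun b
    pres-∘ : ∀ a b → fun (a A.∘ b) ≡ fun a B.∘ fun b

open Hom public

IsFreeOn : (A : LDAlg) → Carrier A → Set₁
IsFreeOn A x =
  ∀ (B : LDAlg) (b : Carrier B) →
    Σ (Hom A B) (λ h → fun h x ≡ b)
    × (∀ (h h′ : Hom A B) → fun h x ≡ fun h′ x → ∀ a → fun h a ≡ fun h′ a)

-- The two operations, as a tag (for the "∗" notation)

data Op : Set where
  dot circ : Op

record StrictLinearOn {X : Set} (D : X → Set) (R : X → X → Set) : Set where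
  field
    irrefl : ∀ a → D a → ¬ R a a
    trans  : ∀ a b c → D a → D b → D c → R a b → R b c → R a c
    total  : ∀ a b → D a → D b → R a b ⊎ (a ≡ b ⊎ R b a)

module _ (A : LDAlg) where
  open LDAlg A hiding (Carrier)
  private
    C = Carrier A

  applyOp : Op → C → C → C
  applyOp dot  a b = a · b
  applyOp circ a b = a ∘ b

  lprod : C → List C → C
  lprod = foldl _·_

  _<L_ : C → C → Set
  p <L q = Σ (List C) λ as → Σ C λ an → Σ Op λ op →
             q ≡ applyOp op (lprod p as) an

  _≤L_ : C → C → Set
  p ≤L q = p <L q ⊎ p ≡ q

data Term (X : Set) : Set where
  leaf : X → Term X
  _·ₜ_ : Term X → Term X → Term X
  _∘ₜ_ : Term X → Term X → Term X

module _ {X : Set} where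

  applyT : Op → Term X → Term X → Term X
  applyT dot  a b = a ·ₜ b
  applyT circ a b = a ∘ₜ b

  lprodT : Term X → List (Term X) → Term X
  lprodT = foldl _·ₜ_

  -- iter k a b = I_{k+1}(a,b)
  iter : ℕ → Term X → Term X → Term X
  iter zero a b = a
  iter (suc zero) a b = a ·ₜ b
  iter (suc (suc k)) a b = iter (suc k) a b ·ₜ iter k a b

  -- b₀ b₁ ⋯ b_{n-1} ∗ b_n (with rest = [b₁,…,b_n]) is prenormal w.r.t. ≺
  Prenormal : (Term X → Term X → Set) → Term X → List (Term X) → Op → Set
  Prenormal _≺_ b₀ rest op =
    (∀ pre x y post → rest ≡ pre ++ x ∷ y ∷ post →
        (y ≺ lprodT b₀ pre) ⊎ (y ≡ lprodT b₀ pre))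
    × (op ≡ circ → ∀ pre x y → rest ≡ pre ++ x ∷ y ∷ [] →
        y ≺ lprodT b₀ pre)

  data Seq : Set where
    fin : List (Term X) → Seq
    inf : (ℕ → Term X) → Seq

  nth : List (Term X) → ℕ → Maybe (Term X)
  nth [] i = nothing
  nth (x ∷ xs) zero = just x
  nth (x ∷ xs) (suc i) = nth xs i

  at : Seq → ℕ → Maybe (Term X)
  at (fin l) i = nth l i
  at (inf f) i = just (f i)

  prepend : List (Term X) → (ℕ → Term X) → ℕ → Term X
  prepend [] f i = f i
  prepend (x ∷ xs) f zero = x
  prepend (x ∷ xs) f (suc i) = prepend xs f i

  ProperPrefix : Seq → Seq → Set
  ProperPrefix s t =
    (∀ i w → at s i ≡ just w → at t i ≡ just w)
    × Σ ℕ λ i → at s i ≡ nothing × Σ (Term X) λ w → at t i ≡ just w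

  FirstDiffLess : (Term X → Term X → Set) → Seq → Seq → Set
  FirstDiffLess _≺_ s t =
    Σ ℕ λ i → Σ (Term X) λ u → Σ (Term X) λ v →
      at s i ≡ just u × at t i ≡ just v × u ≢ v
      × (∀ j → j < i → at s j ≡ at t j) × (u ≺ v)

  SeqLess : (Term X → Term X → Set) → Seq → Seq → Set
  SeqLess _≺_ s t = ProperPrefix s t ⊎ FirstDiffLess _≺_ s t

  data Assoc (p : X) : Term X → Seq → Set where
    one  : ∀ q → Assoc p (leaf q) (fin (leaf q ∷ []))
    dotS : ∀ as an →
      Assoc p (lprodT (leaf p) as ·ₜ an) (fin (leaf p ∷ as ++ an ∷ []))
    circS : ∀ as an →
      Assoc p (lprodT (leaf p) as ∘ₜ an)
        (inf (prepend (leaf p ∷ as ++ an ∷ [])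
                      (λ k → iter k (lprodT (leaf p) as) an)))

module _ (A : LDAlg) where
  P = Carrier A

  record Spec (p : P) (DF : Term P → Set) (Lex : Term P → Term P → Set) : Set where
    field
      linear : StrictLinearOn DF Lex
      leaf-in  : ∀ q → _≤L_ A q p → DF (leaf q)
      leaf-ord : ∀ q r → _≤L_ A q p → _≤L_ A r p →
                 Lex (leaf q) (leaf r) ⇔ _<L_ A q r
      df-char : ∀ w → DF w ⇔
        ((Σ P λ q → _≤L_ A q p × w ≡ leaf q)
         ⊎ (Σ (List (Term P)) λ as → Σ (Term P) λ an → Σ Op λ op →
              w ≡ applyT op (lprodT (leaf p) as) an
              × All DF as × DF an
              × Prenormal Lex (leaf p) (as ++ an ∷ []) op))
      lex-char : ∀ w v s t → DF w → DF v → Assoc p w s → Assoc p v t →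
                 Lex w v ⇔ SeqLess Lex s t

{-# OPTIONS --safe #-}
module Submission where

-- Every term has an associated sequence, read off its left spine, and <Lex is
-- defined inductively as the lexicographic comparison of associated sequences
-- under <Lex itself, with <L on letters as base case; p-DF is then defined by
-- clause (ii).
-- Totality is proved by induction on size: two members of p-DF are compared
-- along the finite parts of their sequences, whose entries are smaller terms,
-- unless one finite part is a proper prefix of the other and the shorter term is
-- a ∘-term.  Its iterates then meet entries of the longer term, and while they
-- agree each iterate is a product of earlier entries, so the first disagreement
-- again compares smaller terms; agreeing to the very end is excluded by the
-- strict ∘-clause of prenormality.  For uniqueness, a second solution has the
-- same members by induction on size, and its order contains <Lex by induction on
-- derivations, hence equals it on p-DF, both being linear.

open import Defs
open import Data.Empty using (⊥-elim)
open import Data.List using (List; []; _∷_; _++_; [_]; _∷ʳ_; _∷ʳ′_; initLast)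
open import Data.List.Properties
  using (foldl-++; ++-assoc; ++-identityʳ; ∷ʳ-injective; ∷ʳ-injectiveˡ)
open import Data.List.Membership.Propositional using (_∈_)
open import Data.List.Membership.Propositional.Properties using (∈-++⁺ʳ)
open import Data.List.Relation.Unary.All as All using (All; []; _∷_)
open import Data.List.Relation.Unary.All.Properties using (++⁻ˡ; ∷ʳ⁺; ∷ʳ⁻)
open import Data.List.Relation.Unary.Any using (here; there)
open import Data.Maybe using (Maybe; just; nothing)
open import Data.Maybe.Properties using (just-injective)
open import Data.Nat using (ℕ; zero; suc; _+_; _≤_; _<_; _⊔_; z≤n; s≤s; _<?_)
open import Data.Nat.Properties
  using ( ≤-refl; ≤-trans; <-trans; <-≤-trans; ≤-pred; <⇒≤; ≮⇒≥; <-cmp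
        ; m≤m+n; m<m+n; m<n+m; m≤m⊔n; m≤n⊔m; n<1+n)
open import Data.Product using (Σ; ∃; _×_; _,_; proj₁; proj₂)
open import Data.Sum as Sum using (_⊎_; inj₁; inj₂)
open import Data.Unit using (⊤; tt)
open import Function using (_∘_)
open import Function.Bundles using (_⇔_; mk⇔; Equivalence)
open import Relation.Binary.Definitions using (Irreflexive; tri<; tri≈; tri>)
open import Relation.Binary.PropositionalEquality
  using (_≡_; _≢_; _≗_; refl; sym; trans; cong; cong₂; cong-app; subst; subst₂)
open import Relation.Nullary using (¬_; yes; no)

module PartialSequences {A : Set} where

  Seqᶠ : Set
  Seqᶠ = ℕ → Maybe A

  private variable
    f f′ g g′ h : Seqᶠ
    R : A → A → Set
    Q : A → Set
    x y : A
    xs : List A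

  []ᶠ : Seqᶠ
  []ᶠ _ = nothing

  infixr 5 _◂_ _⊕_

  _◂_ : A → Seqᶠ → Seqᶠ
  (x ◂ f) zero    = just x
  (x ◂ f) (suc i) = f i

  _⊕_ : List A → Seqᶠ → Seqᶠ
  []       ⊕ f = f
  (x ∷ xs) ⊕ f = x ◂ (xs ⊕ f)

  ⊕-++ : ∀ xs ys f → (xs ++ ys) ⊕ f ≗ xs ⊕ (ys ⊕ f)
  ⊕-++ []       ys f i       = refl
  ⊕-++ (x ∷ xs) ys f zero    = refl
  ⊕-++ (x ∷ xs) ys f (suc i) = ⊕-++ xs ys f i

  ∷ʳ-⊕-nonempty : ∀ xs x f → ((xs ∷ʳ x) ⊕ f) 0 ≢ nothing
  ∷ʳ-⊕-nonempty []      x f ()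
  ∷ʳ-⊕-nonempty (_ ∷ _) x f ()

  -- The same shapes as ProperPrefix, FirstDiffLess and SeqLess of Defs, so
  -- that SeqLess R s t is by definition SeqLessᶠ R (at s) (at t).
  ProperPrefixᶠ : Seqᶠ → Seqᶠ → Set
  ProperPrefixᶠ f g =
    (∀ i w → f i ≡ just w → g i ≡ just w)
    × Σ ℕ λ i → f i ≡ nothing × Σ A λ w → g i ≡ just w

  FirstDiffLessᶠ : (A → A → Set) → Seqᶠ → Seqᶠ → Set
  FirstDiffLessᶠ R f g =
    Σ ℕ λ i → Σ A λ u → Σ A λ v →
      f i ≡ just u × g i ≡ just v × u ≢ v
      × (∀ j → j < i → f j ≡ g j) × R u v

  SeqLessᶠ : (A → A → Set) → Seqᶠ → Seqᶠ → Set
  SeqLessᶠ R f g = ProperPrefixᶠ f g ⊎ FirstDiffLessᶠ R f g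

  Apart : (A → A → Set) → Seqᶠ → Seqᶠ → Set
  Apart R f g = SeqLessᶠ R f g ⊎ SeqLessᶠ R g f

  Comparable : (A → A → Set) → A → A → Set
  Comparable R x y = R x y ⊎ x ≡ y ⊎ R y x

  Comparable-swap : Comparable R x y → Comparable R y x
  Comparable-swap (inj₁ xRy)        = inj₂ (inj₂ xRy)
  Comparable-swap (inj₂ (inj₁ x≡y)) = inj₂ (inj₁ (sym x≡y))
  Comparable-swap (inj₂ (inj₂ yRx)) = inj₁ yRx

  SeqLessᶠ-resp-≗ : f ≗ f′ → g ≗ g′ → SeqLessᶠ R f g → SeqLessᶠ R f′ g′
  SeqLessᶠ-resp-≗ f≗ g≗ (inj₁ (f⊆g , i , fi , w , gi)) =
    inj₁ ( (λ j x e → trans (sym (g≗ j)) (f⊆g j x (trans (f≗ j) e)))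
         , i , trans (sym (f≗ i)) fi , w , trans (sym (g≗ i)) gi)
  SeqLessᶠ-resp-≗ f≗ g≗ (inj₂ (i , u , v , fu , gv , u≢v , f≡g , uRv)) =
    inj₂ ( i , u , v , trans (sym (f≗ i)) fu , trans (sym (g≗ i)) gv , u≢v
         , (λ j j<i → trans (sym (f≗ j)) (trans (f≡g j j<i) (g≗ j))) , uRv)

  SeqLessᶠ-◂ : ∀ x → SeqLessᶠ R f g → SeqLessᶠ R (x ◂ f) (x ◂ g)
  SeqLessᶠ-◂ {f = f} {g} x (inj₁ (f⊆g , i , fi , w , gi)) = inj₁ (⊆-◂ , suc i , fi , w , gi)
    where
    ⊆-◂ : ∀ j w → (x ◂ f) j ≡ just w → (x ◂ g) j ≡ just w
    ⊆-◂ zero    w e = e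
    ⊆-◂ (suc j) w e = f⊆g j w e
  SeqLessᶠ-◂ {f = f} {g} x (inj₂ (i , u , v , fu , gv , u≢v , f≡g , uRv)) =
    inj₂ (suc i , u , v , fu , gv , u≢v , agree , uRv)
    where
    agree : ∀ j → j < suc i → (x ◂ f) j ≡ (x ◂ g) j
    agree zero    _         = refl
    agree (suc j) (s≤s j<i) = f≡g j j<i

  SeqLessᶠ-⊕ : ∀ xs → SeqLessᶠ R f g → SeqLessᶠ R (xs ⊕ f) (xs ⊕ g)
  SeqLessᶠ-⊕ []       s = s
  SeqLessᶠ-⊕ (x ∷ xs) s = SeqLessᶠ-◂ x (SeqLessᶠ-⊕ xs s)

  SeqLessᶠ-head : f 0 ≡ just x → g 0 ≡ just y → x ≢ y → R x y → SeqLessᶠ R f g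
  SeqLessᶠ-head fx gy x≢y xRy = inj₂ (0 , _ , _ , fx , gy , x≢y , (λ _ ()) , xRy)

  []ᶠ-SeqLessᶠ : g 0 ≢ nothing → SeqLessᶠ R []ᶠ g
  []ᶠ-SeqLessᶠ {g = g} g0≢nothing with g 0 in g0
  ... | just w  = inj₁ ((λ _ _ ()) , 0 , refl , w , g0)
  ... | nothing = ⊥-elim (g0≢nothing refl)

  SeqLessᶠ-irrefl : ¬ SeqLessᶠ R f f
  SeqLessᶠ-irrefl (inj₁ (_ , i , fi , _ , fi′)) with trans (sym fi) fi′
  ... | ()
  SeqLessᶠ-irrefl (inj₂ (_ , _ , _ , fu , fv , u≢v , _)) = u≢v (just-injective (trans (sym fu) fv))

  Apart-⊕ : ∀ xs → Apart R f g → Apart R (xs ⊕ f) (xs ⊕ g)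
  Apart-⊕ xs = Sum.map (SeqLessᶠ-⊕ xs) (SeqLessᶠ-⊕ xs)

  Apart-resp-≗ : f ≗ f′ → g ≗ g′ → Apart R f g → Apart R f′ g′
  Apart-resp-≗ f≗ g≗ = Sum.map (SeqLessᶠ-resp-≗ f≗ g≗) (SeqLessᶠ-resp-≗ g≗ f≗)

  DownClosed : Seqᶠ → Set
  DownClosed f = ∀ {i j} → i ≤ j → f i ≡ nothing → f j ≡ nothing

  []ᶠ-downClosed : DownClosed []ᶠ
  []ᶠ-downClosed _ _ = refl

  ⊕-downClosed : ∀ xs → DownClosed f → DownClosed (xs ⊕ f)
  ⊕-downClosed []       closed = closed
  ⊕-downClosed (x ∷ xs) closed {zero}  _         ()
  ⊕-downClosed (x ∷ xs) closed {suc i} (s≤s i≤j) e = ⊕-downClosed xs closed i≤j e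

  ⊆-agree-below : DownClosed f → (∀ i w → f i ≡ just w → g i ≡ just w) →
                  ∀ {j} → f j ≡ just x → ∀ k → k < j → f k ≡ g k
  ⊆-agree-below {f = f} closed f⊆g fj k k<j with f k in fk
  ... | just w  = sym (f⊆g k w fk)
  ... | nothing with trans (sym (closed (<⇒≤ k<j) fk)) fj
  ...   | ()

  properPrefix-trans : DownClosed f → ProperPrefixᶠ f g → SeqLessᶠ R g h → SeqLessᶠ R f h
  properPrefix-trans _ (f⊆g , i , fi , w , gi) (inj₁ (g⊆h , _)) =
    inj₁ ((λ j x e → g⊆h j x (f⊆g j x e)) , i , fi , w , g⊆h i w gi)
  properPrefix-trans {f = f} {h = h} closed (f⊆g , _) (inj₂ (j , u , v , gu , hv , u≢v , g≡h , uRv))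
    with f j in fj
  ... | just x with just-injective (trans (sym (f⊆g j x fj)) gu)
  ...   | refl = inj₂ ( j , x , v , fj , hv , u≢v
                      , (λ k k<j → trans (⊆-agree-below closed f⊆g fj k k<j) (g≡h k k<j)) , uRv)
  properPrefix-trans {f = f} {h = h} closed (f⊆g , _) (inj₂ (j , u , v , gu , hv , u≢v , g≡h , uRv))
    | nothing = inj₁ (f⊆h , j , fj , v , hv)
    where
    f⊆h : ∀ i w → f i ≡ just w → h i ≡ just w
    f⊆h i w fi with i <? j
    ... | yes i<j = trans (sym (g≡h i i<j)) (f⊆g i w fi)
    ... | no  i≮j with trans (sym (closed (≮⇒≥ i≮j) fj)) fi
    ...   | ()

  firstDiff-trans-properPrefix : DownClosed g → FirstDiffLessᶠ R f g → ProperPrefixᶠ g h →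
                                 FirstDiffLessᶠ R f h
  firstDiff-trans-properPrefix closed (i , u , v , fu , gv , u≢v , f≡g , uRv) (g⊆h , _) =
    i , u , v , fu , g⊆h i v gv , u≢v
    , (λ k k<i → trans (f≡g k k<i) (⊆-agree-below closed g⊆h gv k k<i)) , uRv

  firstDiff-trans-< : (d : FirstDiffLessᶠ R f g) (e : FirstDiffLessᶠ R g h) →
                      proj₁ d < proj₁ e → FirstDiffLessᶠ R f h
  firstDiff-trans-< (i , u , v , fu , gv , u≢v , f≡g , uRv) (_ , _ , _ , _ , _ , _ , g≡h , _) i<j =
    i , u , v , fu , trans (sym (g≡h i i<j)) gv , u≢v
    , (λ k k<i → trans (f≡g k k<i) (g≡h k (<-trans k<i i<j))) , uRv

  firstDiff-trans-> : (d : FirstDiffLessᶠ R f g) (e : FirstDiffLessᶠ R g h) →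
                      proj₁ e < proj₁ d → FirstDiffLessᶠ R f h
  firstDiff-trans-> (_ , _ , _ , _ , _ , _ , f≡g , _) (j , u , v , gu , hv , u≢v , g≡h , uRv) j<i =
    j , u , v , trans (f≡g j j<i) gu , hv , u≢v
    , (λ k k<j → trans (f≡g k (<-trans k<j j<i)) (g≡h k k<j)) , uRv

  data ListComparison (R : A → A → Set) (xs ys : List A) : Set where
    first-diff<      : (∀ f g → SeqLessᶠ R (xs ⊕ f) (ys ⊕ g)) → ListComparison R xs ys
    first-diff>      : (∀ f g → SeqLessᶠ R (ys ⊕ g) (xs ⊕ f)) → ListComparison R xs ys
    equal            : xs ≡ ys → ListComparison R xs ys
    proper-prefix    : ∀ z zs → ys ≡ xs ++ z ∷ zs → ListComparison R xs ys
    proper-extension : ∀ z zs → xs ≡ ys ++ z ∷ zs → ListComparison R xs ys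

  compareLists : Irreflexive _≡_ R → ∀ xs ys →
                 (∀ {x y} → x ∈ xs → y ∈ ys → Comparable R x y) → ListComparison R xs ys
  compareLists _ []       []       _ = equal refl
  compareLists _ []       (y ∷ ys) _ = proper-prefix y ys refl
  compareLists _ (x ∷ xs) []       _ = proper-extension x xs refl
  compareLists irrefl (x ∷ xs) (y ∷ ys) cmp with cmp (here refl) (here refl)
  ... | inj₁ xRy        = first-diff< (λ _ _ → SeqLessᶠ-head refl refl (λ e → irrefl e xRy) xRy)
  ... | inj₂ (inj₂ yRx) = first-diff> (λ _ _ → SeqLessᶠ-head refl refl (λ e → irrefl e yRx) yRx)
  ... | inj₂ (inj₁ refl) with compareLists irrefl xs ys (λ x∈ y∈ → cmp (there x∈) (there y∈))
  ...   | first-diff< lt          = first-diff< (λ f g → SeqLessᶠ-◂ x (lt f g))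
  ...   | first-diff> gt          = first-diff> (λ f g → SeqLessᶠ-◂ x (gt f g))
  ...   | equal e                 = equal (cong (x ∷_) e)
  ...   | proper-prefix z zs e    = proper-prefix z zs (cong (x ∷_) e)
  ...   | proper-extension z zs e = proper-extension z zs (cong (x ∷_) e)

  Allᶠ : (A → Set) → Seqᶠ → Set
  Allᶠ Q f = ∀ i {x} → f i ≡ just x → Q x

  Allᶠ-[]ᶠ : Allᶠ Q []ᶠ
  Allᶠ-[]ᶠ _ ()

  Allᶠ-◂ : Q x → Allᶠ Q f → Allᶠ Q (x ◂ f)
  Allᶠ-◂ qx qf zero    refl = qx
  Allᶠ-◂ qx qf (suc i) e    = qf i e

  Allᶠ-⊕ : All Q xs → Allᶠ Q f → Allᶠ Q (xs ⊕ f)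
  Allᶠ-⊕ []         qf = qf
  Allᶠ-⊕ (qx ∷ qxs) qf = Allᶠ-◂ qx (Allᶠ-⊕ qxs qf)

open PartialSequences

∷ʳ-≡-infix : ∀ {A : Set} (K : List A) z pre x y post → K ∷ʳ z ≡ pre ++ x ∷ y ∷ post →
             (∃ λ post′ → K ≡ pre ++ x ∷ y ∷ post′) ⊎ (K ≡ pre ∷ʳ x × z ≡ y)
∷ʳ-≡-infix K z pre x y post e with initLast post
... | []          = inj₂ (∷ʳ-injective K (pre ∷ʳ x) (trans e (sym (++-assoc pre [ x ] [ y ]))))
... | post′ ∷ʳ′ q =
  inj₁ (post′ , proj₁ (∷ʳ-injective K (pre ++ x ∷ y ∷ post′)
                                    (trans e (sym (++-assoc pre (x ∷ y ∷ post′) [ q ])))))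

module _ {X : Set} where

  private variable
    a x : Term X
    as : List (Term X)

  spineHead : Term X → Term X
  spineHead (t ·ₜ _) = spineHead t
  spineHead t        = t

  spineArgs : Term X → List (Term X)
  spineArgs (t ·ₜ a) = spineArgs t ∷ʳ a
  spineArgs _        = []

  spineHead-lprodT : ∀ (b : Term X) as → spineHead (lprodT b as) ≡ spineHead b
  spineHead-lprodT b []       = refl
  spineHead-lprodT b (a ∷ as) = spineHead-lprodT (b ·ₜ a) as

  spineArgs-lprodT : ∀ (b : Term X) as → spineArgs (lprodT b as) ≡ spineArgs b ++ as
  spineArgs-lprodT b []       = sym (++-identityʳ _)
  spineArgs-lprodT b (a ∷ as) =
    trans (spineArgs-lprodT (b ·ₜ a) as) (++-assoc (spineArgs b) [ a ] as)

  lprodT-∷ʳ : ∀ (b : Term X) as a → lprodT b (as ∷ʳ a) ≡ lprodT b as ·ₜ a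
  lprodT-∷ʳ b as a = foldl-++ _·ₜ_ b as [ a ]

  size : Term X → ℕ
  size (leaf _) = 1
  size (t ·ₜ a) = size t + size a
  size (t ∘ₜ a) = size t + size a

  size-pos : ∀ t → 0 < size t
  size-pos (leaf _) = s≤s z≤n
  size-pos (t ·ₜ a) = <-≤-trans (size-pos t) (m≤m+n _ _)
  size-pos (t ∘ₜ a) = <-≤-trans (size-pos t) (m≤m+n _ _)

  size-lprodT-≥ : ∀ (b : Term X) as → size b ≤ size (lprodT b as)
  size-lprodT-≥ b []       = ≤-refl
  size-lprodT-≥ b (a ∷ as) = ≤-trans (m≤m+n (size b) (size a)) (size-lprodT-≥ (b ·ₜ a) as)

  size-∈-lprodT : ∀ b → x ∈ as → size x < size (lprodT b as)
  size-∈-lprodT {x} {x ∷ as} b (here refl) =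
    <-≤-trans (m<n+m (size x) (size-pos b)) (size-lprodT-≥ (b ·ₜ x) as)
  size-∈-lprodT {as = a ∷ as} b (there x∈) = size-∈-lprodT (b ·ₜ a) x∈

  size-lprodT-prefix : ∀ (b : Term X) xs x as → size (lprodT b xs) < size (lprodT b (xs ++ x ∷ as))
  size-lprodT-prefix b xs x as rewrite foldl-++ _·ₜ_ b xs (x ∷ as) =
    <-≤-trans (m<m+n (size (lprodT b xs)) (size-pos x)) (size-lprodT-≥ _ as)

  size-applyT : ∀ op (b : Term X) as a → size (applyT op (lprodT b as) a) ≡ size (lprodT b (as ∷ʳ a))
  size-applyT dot  b as a = cong size (sym (lprodT-∷ʳ b as a))
  size-applyT circ b as a = cong size (sym (lprodT-∷ʳ b as a))

  size-∈ : ∀ op b → x ∈ as ∷ʳ a → size x < size (applyT op (lprodT b as) a)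
  size-∈ {as = as} {a} op b x∈ rewrite size-applyT op b as a = size-∈-lprodT b x∈

  size-prefix : ∀ op b {pre y post} → as ∷ʳ a ≡ pre ++ y ∷ post →
                size (lprodT b pre) < size (applyT op (lprodT b as) a)
  size-prefix {as} {a} op b {pre} {y} {post} e rewrite size-applyT op b as a | e =
    size-lprodT-prefix b pre y post

  iter-shift : ∀ k (u a : Term X) → iter (suc k) u a ≡ iter k (u ·ₜ a) u
  iter-shift zero          u a = refl
  iter-shift (suc zero)    u a = refl
  iter-shift (suc (suc k)) u a = cong₂ _·ₜ_ (iter-shift (suc k) u a) (iter-shift k u a)

  iterSeq : Term X → Term X → Seqᶠ
  iterSeq u a k = just (iter k u a)

  iterSeq-step : ∀ u a → iterSeq u a ≗ u ◂ iterSeq (u ·ₜ a) u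
  iterSeq-step u a zero    = refl
  iterSeq-step u a (suc k) = cong just (iter-shift k u a)

  tailSeq : Op → Term X → Term X → Seqᶠ
  tailSeq dot  _ _ = []ᶠ
  tailSeq circ u a = iterSeq u a

  tailSeq-downClosed : ∀ op u a → DownClosed (tailSeq op u a)
  tailSeq-downClosed dot  u a = []ᶠ-downClosed
  tailSeq-downClosed circ u a _ ()

  -- Defined on all terms, so that Lex below needs no reference to Assoc.
  assocSeq : Term X → Seqᶠ
  assocSeq (leaf q) = leaf q ◂ []ᶠ
  assocSeq (t ·ₜ a) = (spineHead t ∷ spineArgs t ∷ʳ a) ⊕ tailSeq dot t a
  assocSeq (t ∘ₜ a) = (spineHead t ∷ spineArgs t ∷ʳ a) ⊕ tailSeq circ t a

  assocSeq-applyT : ∀ op (t a : Term X) →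
                    assocSeq (applyT op t a) ≡ (spineHead t ∷ spineArgs t ∷ʳ a) ⊕ tailSeq op t a
  assocSeq-applyT dot  t a = refl
  assocSeq-applyT circ t a = refl

  assocSeq-lprodT : ∀ op (q : X) as a →
    assocSeq (applyT op (lprodT (leaf q) as) a) ≡ leaf q ◂ (as ∷ʳ a) ⊕ tailSeq op (lprodT (leaf q) as) a
  assocSeq-lprodT op q as a
    rewrite assocSeq-applyT op (lprodT (leaf q) as) a
          | spineHead-lprodT (leaf q) as
          | spineArgs-lprodT (leaf q) as = refl

  assocSeq-nonempty : ∀ t → assocSeq t 0 ≢ nothing
  assocSeq-nonempty (leaf _) ()
  assocSeq-nonempty (_ ·ₜ _) ()
  assocSeq-nonempty (_ ∘ₜ _) ()

  assocSeq-downClosed : ∀ t → DownClosed (assocSeq t)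
  assocSeq-downClosed (leaf q) = ⊕-downClosed (leaf q ∷ []) []ᶠ-downClosed
  assocSeq-downClosed (t ·ₜ a) =
    ⊕-downClosed (spineHead t ∷ spineArgs t ∷ʳ a) (tailSeq-downClosed dot t a)
  assocSeq-downClosed (t ∘ₜ a) =
    ⊕-downClosed (spineHead t ∷ spineArgs t ∷ʳ a) (tailSeq-downClosed circ t a)

  ⊕-[]ᶠ : ∀ (xs : List (Term X)) → xs ⊕ []ᶠ ≗ nth xs
  ⊕-[]ᶠ []       i       = refl
  ⊕-[]ᶠ (x ∷ xs) zero    = refl
  ⊕-[]ᶠ (x ∷ xs) (suc i) = ⊕-[]ᶠ xs i

  ⊕-prepend : ∀ xs (g : ℕ → Term X) → xs ⊕ (λ k → just (g k)) ≗ (λ k → just (prepend xs g k))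
  ⊕-prepend []       g i       = refl
  ⊕-prepend (x ∷ xs) g zero    = refl
  ⊕-prepend (x ∷ xs) g (suc i) = ⊕-prepend xs g i

  assocSeq-Assoc : ∀ {p w s} → Assoc p w s → assocSeq w ≗ at s
  assocSeq-Assoc (one q) = ⊕-[]ᶠ (leaf q ∷ [])
  assocSeq-Assoc {p} (dotS as an) i =
    trans (cong-app (assocSeq-lprodT dot p as an) i) (⊕-[]ᶠ (leaf p ∷ as ∷ʳ an) i)
  assocSeq-Assoc {p} (circS as an) i =
    trans (cong-app (assocSeq-lprodT circ p as an) i)
          (⊕-prepend (leaf p ∷ as ∷ʳ an) (λ k → iter k (lprodT (leaf p) as) an) i)

module Construction (A : LDAlg) (lin : StrictLinearOn (λ _ → ⊤) (_<L_ A)) (p : Carrier A) where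

  private
    C = Carrier A
    T = Term C

    variable
      q r o : C
      w v x y : T
      as bs K : List T
      an bn : T
      op op′ : Op
      n : ℕ

  _≺_ : C → C → Set
  _≺_ = _<L_ A

  ≺-irrefl : ¬ q ≺ q
  ≺-irrefl = StrictLinearOn.irrefl lin _ tt

  ≺-trans : q ≺ r → r ≺ o → q ≺ o
  ≺-trans = StrictLinearOn.trans lin _ _ _ tt tt tt

  lp : List T → T
  lp = lprodT (leaf p)

  -- seq< alone would compare two letters only through Lex on the same letters.
  data Lex : T → T → Set where
    leaf< : q ≺ r → Lex (leaf q) (leaf r)
    seq<  : SeqLessᶠ Lex (assocSeq w) (assocSeq v) → Lex w v

  -- The first clause of Prenormal R (leaf p) K op, the only one not depending on op.
  Prenormal₁ : (T → T → Set) → List T → Set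
  Prenormal₁ R K = ∀ pre x y post → K ≡ pre ++ x ∷ y ∷ post → R y (lp pre) ⊎ y ≡ lp pre

  data DF : T → Set where
    leaf≤    : _≤L_ A q p → DF (leaf q)
    compound : All DF as → DF an → Prenormal Lex (leaf p) (as ∷ʳ an) op → DF (applyT op (lp as) an)

  Lex-irrefl : Irreflexive _≡_ Lex
  Lex-irrefl refl (leaf< q≺q) = ≺-irrefl q≺q
  Lex-irrefl refl (seq< s)    = SeqLessᶠ-irrefl s

  Lex⇒≢ : Lex x y → x ≢ y
  Lex⇒≢ l e = Lex-irrefl e l

  Lex-head : ∀ {f g} → f 0 ≡ just x → g 0 ≡ just y → Lex x y → SeqLessᶠ Lex f g
  Lex-head fx gy l = SeqLessᶠ-head fx gy (Lex⇒≢ l) l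

  Lex-leaf⁻ : Lex (leaf q) (leaf r) → q ≺ r
  Lex-leaf⁻ (leaf< q≺r)                                            = q≺r
  Lex-leaf⁻ (seq< (inj₁ (_ , zero , () , _)))
  Lex-leaf⁻ (seq< (inj₁ (_ , suc _ , _ , _ , ())))
  Lex-leaf⁻ (seq< (inj₂ (zero , _ , _ , refl , refl , _ , _ , d))) = Lex-leaf⁻ d
  Lex-leaf⁻ (seq< (inj₂ (suc _ , _ , _ , () , _)))

  Lex-trans : Lex x y → Lex y w → Lex x w
  Lex-trans (leaf< q≺r) (leaf< r≺o) = leaf< (≺-trans q≺r r≺o)
  Lex-trans (leaf< q≺r) (seq< (inj₁ (y⊆w , _))) =
    seq< (Lex-head refl (y⊆w 0 _ refl) (leaf< q≺r))
  Lex-trans (leaf< q≺r) (seq< (inj₂ (zero , _ , _ , refl , w0 , _ , _ , d))) =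
    seq< (Lex-head refl w0 (Lex-trans (leaf< q≺r) d))
  Lex-trans (leaf< _) (seq< (inj₂ (suc _ , _ , _ , () , _)))
  Lex-trans {x} (seq< (inj₁ (_ , zero , x0 , _))) (leaf< _) = ⊥-elim (assocSeq-nonempty x x0)
  Lex-trans (seq< (inj₁ (_ , suc _ , _ , _ , ()))) (leaf< _)
  Lex-trans (seq< (inj₂ (zero , _ , _ , x0 , refl , _ , _ , d))) (leaf< r≺o) =
    seq< (Lex-head x0 refl (Lex-trans d (leaf< r≺o)))
  Lex-trans (seq< (inj₂ (suc _ , _ , _ , _ , () , _))) (leaf< _)
  Lex-trans {x} (seq< (inj₁ pp)) (seq< s) = seq< (properPrefix-trans (assocSeq-downClosed x) pp s)
  Lex-trans {y = y} (seq< (inj₂ d)) (seq< (inj₁ pp)) =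
    seq< (inj₂ (firstDiff-trans-properPrefix (assocSeq-downClosed y) d pp))
  Lex-trans (seq< (inj₂ d₁@(i , u , _ , xu , yv , _ , x≡y , u<v)))
            (seq< (inj₂ d₂@(j , _ , t , yv′ , wt , _ , y≡w , v<t))) with <-cmp i j
  ... | tri< i<j _ _ = seq< (inj₂ (firstDiff-trans-< d₁ d₂ i<j))
  ... | tri> _ _ j<i = seq< (inj₂ (firstDiff-trans-> d₁ d₂ j<i))
  ... | tri≈ _ refl _ with just-injective (trans (sym yv) yv′)
  ...   | refl =
    seq< (inj₂ (i , u , t , xu , wt , Lex⇒≢ u<t , (λ k k<i → trans (x≡y k k<i) (y≡w k k<i)) , u<t))
    where u<t = Lex-trans u<v v<t

  DFShape : (T → Set) → (T → T → Set) → T → Set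
  DFShape D R w =
    (Σ C λ q → _≤L_ A q p × w ≡ leaf q)
    ⊎ (Σ (List T) λ as → Σ T λ an → Σ Op λ op →
         w ≡ applyT op (lp as) an × All D as × D an × Prenormal R (leaf p) (as ++ an ∷ []) op)

  DF-char : ∀ w → DF w ⇔ DFShape DF Lex w
  DF-char w = mk⇔ unfold fold
    where
    unfold : DF w → DFShape DF Lex w
    unfold (leaf≤ q≤p)         = inj₁ (_ , q≤p , refl)
    unfold (compound all d pn) = inj₂ (_ , _ , _ , refl , all , d , pn)
    fold : DFShape DF Lex w → DF w
    fold (inj₁ (_ , q≤p , refl))                  = leaf≤ q≤p
    fold (inj₂ (_ , _ , _ , refl , all , d , pn)) = compound all d pn

  Prenormal₁-++⁻ˡ : ∀ {R} xs {ys} → Prenormal₁ R (xs ++ ys) → Prenormal₁ R xs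
  Prenormal₁-++⁻ˡ xs {ys} pn pre x y post e =
    pn pre x y (post ++ ys) (trans (cong (_++ ys) e) (++-assoc pre (x ∷ y ∷ post) ys))

  Prenormal₁-∷ʳ : ∀ {R z} → Prenormal₁ R K →
                  (∀ pre x → K ≡ pre ∷ʳ x → R z (lp pre) ⊎ z ≡ lp pre) → Prenormal₁ R (K ∷ʳ z)
  Prenormal₁-∷ʳ {K} {z = z} pn last pre x y post e with ∷ʳ-≡-infix K z pre x y post e
  ... | inj₁ (post′ , e′) = pn pre x y post′ e′
  ... | inj₂ (e′ , refl)  = last pre x e′

  module Characterised {D : T → Set} {R : T → T → Set} (char : ∀ w → D w ⇔ DFShape D R w) where

    unfold : D w → DFShape D R w
    unfold = Equivalence.to (char _)

    fold : DFShape D R w → D w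
    fold = Equivalence.from (char _)

    D-leaf-p : D (leaf p)
    D-leaf-p = fold (inj₁ (p , inj₂ refl , refl))

    D-leaf⇒≤ : D (leaf q) → _≤L_ A q p
    D-leaf⇒≤ d with unfold d
    ... | inj₁ (_ , q≤p , refl)        = q≤p
    ... | inj₂ (_ , _ , dot  , () , _)
    ... | inj₂ (_ , _ , circ , () , _)

    D-lp : All D K → Prenormal₁ R K → D (lp K)
    D-lp {K} all pn with initLast K
    ... | []       = D-leaf-p
    ... | K′ ∷ʳ′ x =
      subst D (sym (lprodT-∷ʳ (leaf p) K′ x))
        (fold (inj₂ (K′ , x , dot , refl , proj₁ (∷ʳ⁻ all) , proj₂ (∷ʳ⁻ all) , pn , λ ())))

    D-lp-prefix : ∀ xs {ys} → All D (xs ++ ys) → Prenormal₁ R (xs ++ ys) → D (lp xs)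
    D-lp-prefix xs all pn = D-lp (++⁻ˡ xs all) (Prenormal₁-++⁻ˡ {R} xs pn)

    -- iter (suc k) (lp as) an = iter k (lp (as ∷ʳ an)) (lp as), and appending lp as to
    -- as ∷ʳ an keeps the list prenormal, lp as being exactly the bound it must respect.
    D-iter : ∀ as an → All D (as ∷ʳ an) → Prenormal₁ R (as ∷ʳ an) → ∀ k → D (iter k (lp as) an)
    D-iter as an all pn zero    = D-lp-prefix as all pn
    D-iter as an all pn (suc k) =
      subst D (sym shift)
        (D-iter (as ∷ʳ an) (lp as) (∷ʳ⁺ all (D-lp-prefix as all pn))
                (Prenormal₁-∷ʳ {R = R} pn last) k)
      where
      shift : iter (suc k) (lp as) an ≡ iter k (lp (as ∷ʳ an)) (lp as)
      shift = trans (iter-shift k (lp as) an)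
                    (cong (λ u → iter k u (lp as)) (sym (lprodT-∷ʳ (leaf p) as an)))
      last : ∀ pre x → as ∷ʳ an ≡ pre ∷ʳ x → R (lp as) (lp pre) ⊎ lp as ≡ lp pre
      last pre x e = inj₂ (cong lp (∷ʳ-injectiveˡ as pre e))

    D-assocSeq : D w → Allᶠ D (assocSeq w)
    D-assocSeq d with unfold d
    ... | inj₁ (_ , _ , refl) = Allᶠ-◂ d Allᶠ-[]ᶠ
    ... | inj₂ (as , an , op , refl , all-as , d-an , pn , _) =
      subst (Allᶠ D) (sym (assocSeq-lprodT op p as an))
        (Allᶠ-◂ D-leaf-p (Allᶠ-⊕ all (tailSeq-All op)))
      where
      all = ∷ʳ⁺ all-as d-an
      tailSeq-All : ∀ op → Allᶠ D (tailSeq op (lp as) an)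
      tailSeq-All dot       = Allᶠ-[]ᶠ
      tailSeq-All circ k refl = D-iter as an all pn k

    D-Assoc : D w → ∃ (Assoc p w)
    D-Assoc d with unfold d
    ... | inj₁ (q , _ , refl)              = _ , one q
    ... | inj₂ (as , an , dot  , refl , _) = _ , dotS as an
    ... | inj₂ (as , an , circ , refl , _) = _ , circS as an

  elems : Op → List T → T → Seqᶠ
  elems op as an = (as ∷ʳ an) ⊕ tailSeq op (lp as) an

  Lex-compound : ∀ op as an op′ bs bn → SeqLessᶠ Lex (elems op as an) (elems op′ bs bn) →
                 Lex (applyT op (lp as) an) (applyT op′ (lp bs) bn)
  Lex-compound op as an op′ bs bn s =
    seq< (subst₂ (SeqLessᶠ Lex) (sym (assocSeq-lprodT op p as an)) (sym (assocSeq-lprodT op′ p bs bn))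
                 (SeqLessᶠ-◂ (leaf p) s))

  Apart⇒Comparable : ∀ op as an op′ bs bn → Apart Lex (elems op as an) (elems op′ bs bn) →
                     Comparable Lex (applyT op (lp as) an) (applyT op′ (lp bs) bn)
  Apart⇒Comparable op as an op′ bs bn (inj₁ lt) = inj₁ (Lex-compound op as an op′ bs bn lt)
  Apart⇒Comparable op as an op′ bs bn (inj₂ gt) = inj₂ (inj₂ (Lex-compound op′ bs bn op as an gt))

  leaf<compound : ∀ op bs bn → _≤L_ A q p → Lex (leaf q) (applyT op (lp bs) bn)
  leaf<compound op bs bn (inj₁ q≺p) =
    seq< (Lex-head refl (cong-app (assocSeq-lprodT op p bs bn) 0) (leaf< q≺p))
  leaf<compound op bs bn (inj₂ refl) =
    seq< (subst (SeqLessᶠ Lex _) (sym (assocSeq-lprodT op p bs bn))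
                (SeqLessᶠ-◂ (leaf p) ([]ᶠ-SeqLessᶠ (∷ʳ-⊕-nonempty bs bn _))))

  same-args-comparable : ∀ op op′ as an →
                         Comparable Lex (applyT op (lp as) an) (applyT op′ (lp as) an)
  same-args-comparable dot  dot  as an = inj₂ (inj₁ refl)
  same-args-comparable circ circ as an = inj₂ (inj₁ refl)
  same-args-comparable dot  circ as an =
    Apart⇒Comparable dot as an circ as an (inj₁ (SeqLessᶠ-⊕ (as ∷ʳ an) ([]ᶠ-SeqLessᶠ λ ())))
  same-args-comparable circ dot  as an =
    Apart⇒Comparable circ as an dot as an (inj₂ (SeqLessᶠ-⊕ (as ∷ʳ an) ([]ᶠ-SeqLessᶠ λ ())))

  -- Invariant: the iterates still to be compared are those of (lp K, l), where
  -- K ∷ʳ l are the entries of bs ∷ʳ bn matched so far.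
  iterates-apart : Prenormal Lex (leaf p) (bs ∷ʳ bn) op →
    (∀ K l r R → bs ∷ʳ bn ≡ K ++ l ∷ r ∷ R → Comparable Lex (lp K) r) →
    ∀ K l r R → bs ∷ʳ bn ≡ K ++ l ∷ r ∷ R →
    Apart Lex (iterSeq (lp K) l) ((r ∷ R) ⊕ tailSeq op (lp bs) bn)
  iterates-apart pn cmp K l r R e with cmp K l r R e
  ... | inj₁ lt        = inj₁ (Lex-head refl refl lt)
  ... | inj₂ (inj₂ gt) = inj₂ (Lex-head refl refl gt)
  iterates-apart {op = dot} pn cmp K l r [] e | inj₂ (inj₁ refl) =
    inj₂ (SeqLessᶠ-resp-≗ (λ _ → refl) (sym ∘ iterSeq-step (lp K) l)
           (SeqLessᶠ-◂ (lp K) ([]ᶠ-SeqLessᶠ λ ())))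
  iterates-apart {op = circ} pn cmp K l r [] e | inj₂ (inj₁ refl) =
    ⊥-elim (Lex-irrefl refl (proj₂ pn refl K l (lp K) e))
  iterates-apart pn cmp K l r (r′ ∷ R) e | inj₂ (inj₁ refl) =
    Apart-resp-≗ (sym ∘ iterSeq-step (lp K) l) (λ _ → refl)
      (Apart-⊕ (lp K ∷ [])
        (subst (λ u → Apart Lex (iterSeq u (lp K)) _) (lprodT-∷ʳ (leaf p) K l)
          (iterates-apart pn cmp (K ∷ʳ l) (lp K) r′ R
                          (trans e (sym (++-assoc K [ l ] (lp K ∷ r′ ∷ R)))))))

  private module DF-char = Characterised {DF} {Lex} DF-char

  Below : ℕ → Set
  Below n = ∀ {x y} → size x < n → size y < n → DF x → DF y → Comparable Lex x y

  prefix-products-comparable : Below n → size (applyT op (lp bs) bn) ≤ n →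
    All DF (bs ∷ʳ bn) → Prenormal₁ Lex (bs ∷ʳ bn) →
    ∀ K l r R → bs ∷ʳ bn ≡ K ++ l ∷ r ∷ R → Comparable Lex (lp K) r
  prefix-products-comparable {op = op} {bs} {bn} below v≤n all pn K l r R e =
    below (<-≤-trans (size-prefix op (leaf p) e) v≤n) (<-≤-trans (size-∈ op (leaf p) r∈) v≤n)
          (DF-char.D-lp-prefix K (subst (All DF) e all) (subst (Prenormal₁ Lex) e pn))
          (All.lookup all r∈)
    where
    r∈ : r ∈ bs ∷ʳ bn
    r∈ = subst (r ∈_) (sym e) (∈-++⁺ʳ K (there (here refl)))

  proper-prefix-comparable : Below n → size (applyT op′ (lp bs) bn) ≤ n →
    All DF (bs ∷ʳ bn) → Prenormal Lex (leaf p) (bs ∷ʳ bn) op′ →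
    ∀ op as an z Z → bs ∷ʳ bn ≡ (as ∷ʳ an) ++ z ∷ Z →
    Comparable Lex (applyT op (lp as) an) (applyT op′ (lp bs) bn)
  proper-prefix-comparable {op′ = op′} {bs} {bn} below v≤n all pn op as an z Z e =
    Apart⇒Comparable op as an op′ bs bn
      (Apart-resp-≗ (λ _ → refl) (sym ∘ split) (Apart-⊕ (as ∷ʳ an) (rest op)))
    where
    split : elems op′ bs bn ≗ (as ∷ʳ an) ⊕ (z ∷ Z) ⊕ tailSeq op′ (lp bs) bn
    split i = trans (cong (λ L → (L ⊕ tailSeq op′ (lp bs) bn) i) e) (⊕-++ (as ∷ʳ an) (z ∷ Z) _ i)
    rest : ∀ op → Apart Lex (tailSeq op (lp as) an) ((z ∷ Z) ⊕ tailSeq op′ (lp bs) bn)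
    rest dot  = inj₁ ([]ᶠ-SeqLessᶠ λ ())
    rest circ = iterates-apart pn (prefix-products-comparable {op = op′} below v≤n all (proj₁ pn))
                               as an z Z (trans e (++-assoc as [ an ] (z ∷ Z)))

  comparable-step : Below n → size w ≤ n → size v ≤ n → DF w → DF v → Comparable Lex w v
  comparable-step _ _ _ (leaf≤ {q} _) (leaf≤ {r} _) =
    Sum.map leaf< (Sum.map (cong leaf) leaf<) (StrictLinearOn.total lin q r tt tt)
  comparable-step _ _ _ (leaf≤ q≤p) (compound {bs} {bn} {op} _ _ _) =
    inj₁ (leaf<compound op bs bn q≤p)
  comparable-step _ _ _ (compound {as} {an} {op} _ _ _) (leaf≤ r≤p) =
    inj₂ (inj₂ (leaf<compound op as an r≤p))
  comparable-step below w≤n v≤n (compound {as} {an} {op} all-as d-an pn)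
                                (compound {bs} {bn} {op′} all-bs d-bn pn′)
    with compareLists Lex-irrefl (as ∷ʳ an) (bs ∷ʳ bn)
           (λ x∈ y∈ → below (<-≤-trans (size-∈ op (leaf p) x∈) w≤n)
                            (<-≤-trans (size-∈ op′ (leaf p) y∈) v≤n)
                            (All.lookup (∷ʳ⁺ all-as d-an) x∈) (All.lookup (∷ʳ⁺ all-bs d-bn) y∈))
  ... | first-diff< lt = Apart⇒Comparable op as an op′ bs bn (inj₁ (lt _ _))
  ... | first-diff> gt = Apart⇒Comparable op as an op′ bs bn (inj₂ (gt _ _))
  ... | equal e with ∷ʳ-injective as bs e
  ...   | refl , refl = same-args-comparable op op′ as an
  comparable-step below w≤n v≤n (compound {as} {an} {op} all-as d-an pn)
                                (compound {bs} {bn} {op′} all-bs d-bn pn′)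
    | proper-prefix z Z e =
    proper-prefix-comparable below v≤n (∷ʳ⁺ all-bs d-bn) pn′ op as an z Z e
  comparable-step below w≤n v≤n (compound {as} {an} {op} all-as d-an pn)
                                (compound {bs} {bn} {op′} all-bs d-bn pn′)
    | proper-extension z Z e =
    Comparable-swap {R = Lex} (proper-prefix-comparable below w≤n (∷ʳ⁺ all-as d-an) pn op′ bs bn z Z e)

  comparable-below : ∀ n → Below n
  comparable-below zero    ()
  comparable-below (suc n) w<n v<n = comparable-step (comparable-below n) (≤-pred w<n) (≤-pred v<n)

  Lex-total : DF w → DF v → Comparable Lex w v
  Lex-total {w} {v} = comparable-below (suc (size w ⊔ size v)) (s≤s (m≤m⊔n _ _)) (s≤s (m≤n⊔m _ _))

  Lex⇒SeqLess : ∀ {s t} → Assoc p w s → Assoc p v t → Lex w v → SeqLess Lex s t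
  Lex⇒SeqLess aw      av      (seq< s)    = SeqLessᶠ-resp-≗ (assocSeq-Assoc aw) (assocSeq-Assoc av) s
  Lex⇒SeqLess (one q) (one r) (leaf< q≺r) = Lex-head refl refl (leaf< q≺r)

  SeqLess⇒Lex : ∀ {s t} → Assoc p w s → Assoc p v t → SeqLess Lex s t → Lex w v
  SeqLess⇒Lex aw av s = seq< (SeqLessᶠ-resp-≗ (sym ∘ assocSeq-Assoc aw) (sym ∘ assocSeq-Assoc av) s)

  spec : Spec A p DF Lex
  spec = record
    { linear   = record
      { irrefl = λ _ _ → Lex-irrefl refl
      ; trans  = λ _ _ _ _ _ _ → Lex-trans
      ; total  = λ _ _ → Lex-total
      }
    ; leaf-in  = λ _ → leaf≤
    ; leaf-ord = λ _ _ _ _ → mk⇔ Lex-leaf⁻ leaf<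
    ; df-char  = DF-char
    ; lex-char = λ _ _ _ _ _ _ aw av → mk⇔ (Lex⇒SeqLess aw av) (SeqLess⇒Lex aw av)
    }

  module Transport {D₁ R₁ D₂ R₂}
    (char₁ : ∀ w → D₁ w ⇔ DFShape D₁ R₁ w) (char₂ : ∀ w → D₂ w ⇔ DFShape D₂ R₂ w)
    (R₁⇒R₂ : ∀ {y z} → D₁ y → D₁ z → D₂ y → D₂ z → R₁ y z → R₂ y z) where

    private
      module C₁ = Characterised {D₁} {R₁} char₁
      module C₂ = Characterised {D₂} {R₂} char₂

    transport : ∀ n → size w < n → D₁ w → D₂ w
    transport (suc n) w<n d with C₁.unfold d
    ... | inj₁ leaf-case = C₂.fold (inj₁ leaf-case)
    ... | inj₂ (as , an , op , refl , all-as , d-an , pn₁ , pn₂) =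
      C₂.fold (inj₂ ( as , an , op , refl , proj₁ (∷ʳ⁻ all₂) , proj₂ (∷ʳ⁻ all₂)
                    , (λ pre x y post e → Sum.map₁ (convert e) (pn₁ pre x y post e))
                    , (λ op≡circ pre x y e → convert e (pn₂ op≡circ pre x y e))))
      where
      all₁ : All D₁ (as ∷ʳ an)
      all₁ = ∷ʳ⁺ all-as d-an
      lower : ∀ {x} → size x < size (applyT op (lp as) an) → D₁ x → D₂ x
      lower x<w = transport n (<-≤-trans x<w (≤-pred w<n))
      all₂ : All D₂ (as ∷ʳ an)
      all₂ = All.tabulate (λ x∈ → lower (size-∈ op (leaf p) x∈) (All.lookup all₁ x∈))
      convert : ∀ {pre x y post} → as ∷ʳ an ≡ pre ++ x ∷ y ∷ post →
                R₁ y (lp pre) → R₂ y (lp pre)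
      convert {pre} {x} {y} e =
        R₁⇒R₂ (All.lookup all₁ y∈) pre₁
              (All.lookup all₂ y∈) (lower (size-prefix op (leaf p) e) pre₁)
        where
        y∈ : y ∈ as ∷ʳ an
        y∈ = subst (y ∈_) (sym e) (∈-++⁺ʳ pre (there (here refl)))
        pre₁ : D₁ (lp pre)
        pre₁ = C₁.D-lp-prefix pre (subst (All D₁) e all₁) (subst (Prenormal₁ R₁) e pn₁)

  module Uniqueness {DF′ Lex′} (S′ : Spec A p DF′ Lex′) where
    open Spec S′ using (leaf-ord; lex-char)
    open StrictLinearOn (Spec.linear S′) renaming (irrefl to irrefl′; trans to trans′)
    private module C′ = Characterised {DF′} {Lex′} (Spec.df-char S′)

    seq⇒Lex′ : DF′ w → DF′ v → SeqLessᶠ Lex′ (assocSeq w) (assocSeq v) → Lex′ w v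
    seq⇒Lex′ {w} {v} dw dv s with C′.D-Assoc dw | C′.D-Assoc dv
    ... | s′ , aw | t′ , av =
      Equivalence.from (lex-char w v s′ t′ dw dv aw av)
        (SeqLessᶠ-resp-≗ (assocSeq-Assoc aw) (assocSeq-Assoc av) s)

    Lex⇒Lex′ : Lex w v → DF′ w → DF′ v → Lex′ w v
    Lex⇒Lex′ (leaf< {q} {r} q≺r) dq dr =
      Equivalence.from (leaf-ord q r (C′.D-leaf⇒≤ dq) (C′.D-leaf⇒≤ dr)) q≺r
    Lex⇒Lex′ (seq< (inj₁ pp)) dw dv = seq⇒Lex′ dw dv (inj₁ pp)
    Lex⇒Lex′ (seq< (inj₂ (i , u , u′ , wu , vu′ , u≢u′ , agree , d))) dw dv =
      seq⇒Lex′ dw dv (inj₂ ( i , u , u′ , wu , vu′ , u≢u′ , agree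
                           , Lex⇒Lex′ d (C′.D-assocSeq dw i wu) (C′.D-assocSeq dv i vu′)))

    Lex′⇒Lex : DF w → DF v → DF′ w → DF′ v → Lex′ w v → Lex w v
    Lex′⇒Lex dw dv dw′ dv′ l′ with Lex-total dw dv
    ... | inj₁ l           = l
    ... | inj₂ (inj₁ refl) = ⊥-elim (irrefl′ _ dw′ l′)
    ... | inj₂ (inj₂ l)    =
      ⊥-elim (irrefl′ _ dw′ (trans′ _ _ _ dw′ dv′ dw′ l′ (Lex⇒Lex′ l dv′ dw′)))

    DF⇒DF′ : DF w → DF′ w
    DF⇒DF′ {w} = Transport.transport DF-char (Spec.df-char S′)
                   (λ _ _ dy′ dz′ l → Lex⇒Lex′ l dy′ dz′) (suc (size w)) (n<1+n _)

    DF′⇒DF : DF′ w → DF w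
    DF′⇒DF {w} = Transport.transport (Spec.df-char S′) DF-char
                   (λ dy′ dz′ dy dz → Lex′⇒Lex dy dz dy′ dz′) (suc (size w)) (n<1+n _)

    unique : (∀ w → DF w ⇔ DF′ w) × (∀ w v → DF w → DF v → Lex w v ⇔ Lex′ w v)
    unique = (λ _ → mk⇔ DF⇒DF′ DF′⇒DF)
           , (λ _ _ dw dv → mk⇔ (λ l → Lex⇒Lex′ l (DF⇒DF′ dw) (DF⇒DF′ dv))
                                (Lex′⇒Lex dw dv (DF⇒DF′ dw) (DF⇒DF′ dv)))

lemma2 : (A : LDAlg) (x : Carrier A) → IsFreeOn A x →
           StrictLinearOn (λ _ → ⊤) (_<L_ A) →
           (p : Carrier A) →
           Σ (Term (Carrier A) → Set) λ DF →
           Σ (Term (Carrier A) → Term (Carrier A) → Set) λ Lex →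
             Spec A p DF Lex
             × (∀ DF′ Lex′ → Spec A p DF′ Lex′ →
                  (∀ w → DF w ⇔ DF′ w)
                  × (∀ w v → DF w → DF v → Lex w v ⇔ Lex′ w v))
lemma2 A _ _ lin p = DF , Lex , spec , λ _ _ S′ → Uniqueness.unique S′
  where open Construction A lin p
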